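{- Each of the matroids $U_{2,4}\oplus U_{1,1}$, $U_{2,4}\oplus U_{0,1}$, and $R_6$ is an excluded minor for the class $\mathcal{Z}$ and also an excluded minor for the class $\mathcal{R}$.
   Context: $\mathcal{Z}$ is the class of matroids $M$ such that, for every $e\in E(M)$, at least one of $M\backslash e$ and $M/e$ is binary. $\mathcal{R}$ is the class of matroids that are binary or can be obtained from a binary matroid by relaxing a circuit-hyperplane (relaxing a circuit-hyperplane $H$ of $M$ gives the matroid on $E(M)$ whose bases are those of $M$ together with $H$). An excluded minor for a minor-closed class is a matroid not in the class all of whose proper minors are in it. $R_6\cong U_{2,4}\oplus_2 U_{2,4}$ is the six-element rank-3 matroid whose non-spanning circuits are exactly two disjoint 3-element circuits. -}

module Defs where

open import Data.Nat using (ℕ; zero; suc; _+_; _∸_; _≤_; _<_; _⊓_)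
open import Data.Bool using (Bool; true; false; if_then_else_; _xor_; _∧_; _∨_)
open import Data.Fin using (Fin; zero; suc)
open import Data.Vec using (Vec; []; _∷_; replicate; zipWith)
open import Data.Fin.Subset using (Subset; _∈_; _∉_; _⊆_; _⊂_; _∪_; _∩_; _─_; ∣_∣; ⁅_⁆; ⊥; ⊤; Nonempty; Empty)
open import Data.Product using (Σ; _×_; _,_)
open import Data.Sum using (_⊎_)
open import Relation.Nullary using (¬_)
open import Relation.Binary.PropositionalEquality using (_≡_; _≢_)
open import Function.Bundles using (_⇔_)

-- Elements are labelled by Fin n; the ground set is a subset E of Fin n,
-- and the rank function is only relevant on subsets of E.  This lets
-- deletions and contractions keep the same labels, so no isomorphism
-- bookkeeping is needed (all classes below are defined intrinsically).

record RawMatroid (n : ℕ) : Set where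
  constructor mkRaw
  field
    E  : Subset n
    rk : Subset n → ℕ
open RawMatroid public

record IsMatroid {n : ℕ} (M : RawMatroid n) : Set where
  field
    R1 : ∀ X → X ⊆ E M → rk M X ≤ ∣ X ∣
    R2 : ∀ X Y → Y ⊆ E M → X ⊆ Y → rk M X ≤ rk M Y
    R3 : ∀ X Y → X ⊆ E M → Y ⊆ E M →
         rk M (X ∪ Y) + rk M (X ∩ Y) ≤ rk M X + rk M Y

module _ {n : ℕ} (M : RawMatroid n) where

  Indep : Subset n → Set
  Indep X = X ⊆ E M × rk M X ≡ ∣ X ∣

  IsBasis : Subset n → Set
  IsBasis B = Indep B × rk M B ≡ rk M (E M)

  IsCircuit : Subset n → Set
  IsCircuit C = C ⊆ E M × ¬ Indep C × (∀ Y → Y ⊂ C → Indep Y)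

  IsHyperplane : Subset n → Set
  IsHyperplane H = H ⊆ E M × suc (rk M H) ≡ rk M (E M)
                 × (∀ e → e ∈ E M → e ∉ H → rk M H < rk M (H ∪ ⁅ e ⁆))

  IsCircuitHyperplane : Subset n → Set
  IsCircuitHyperplane H = IsCircuit H × IsHyperplane H

minor : {n : ℕ} → RawMatroid n → (C D : Subset n) → RawMatroid n
minor M C D = mkRaw (E M ─ (C ∪ D)) (λ X → rk M (X ∪ C) ∸ rk M C)

_＼_ : {n : ℕ} → RawMatroid n → Fin n → RawMatroid n
M ＼ e = minor M ⊥ ⁅ e ⁆

_／_ : {n : ℕ} → RawMatroid n → Fin n → RawMatroid n
M ／ e = minor M ⁅ e ⁆ ⊥

-- A column vector over GF(2) is a Vec Bool m (addition = xor).
-- A set X of columns is linearly dependent over GF(2) iff some nonempty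
-- Y ⊆ X has column sum 0 (GF(2) coefficients are 0/1).

colSum : {n m : ℕ} → (Fin n → Vec Bool m) → Subset n → Vec Bool m
colSum {zero}  A []      = replicate _ false
colSum {suc n} A (b ∷ Y) =
  if b then zipWith _xor_ (A zero) (colSum (λ i → A (suc i)) Y)
       else colSum (λ i → A (suc i)) Y

LinIndepGF2 : {n m : ℕ} → (Fin n → Vec Bool m) → Subset n → Set
LinIndepGF2 {m = m} A X =
  ∀ Y → Y ⊆ X → Nonempty Y → colSum A Y ≢ replicate m false

Binary : {n : ℕ} → RawMatroid n → Set
Binary {n} M = Σ ℕ λ m → Σ (Fin n → Vec Bool m) λ A →
  ∀ X → X ⊆ E M → (Indep M X ⇔ LinIndepGF2 A X)

ClassZ : {n : ℕ} → RawMatroid n → Set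
ClassZ M = ∀ e → e ∈ E M → Binary (M ＼ e) ⊎ Binary (M ／ e)

-- M is binary, or M is obtained from a binary matroid N (on the same
-- ground set) by relaxing a circuit-hyperplane H of N.
ClassR : {n : ℕ} → RawMatroid n → Set
ClassR {n} M = Binary M ⊎
  (Σ (RawMatroid n) λ N → IsMatroid N × Binary N × E N ≡ E M ×
     Σ (Subset n) λ H → IsCircuitHyperplane N H ×
       (∀ B → IsBasis M B ⇔ (IsBasis N B ⊎ B ≡ H)))

ExcludedMinor : {n : ℕ} → (RawMatroid n → Set) → RawMatroid n → Set
ExcludedMinor P M = ¬ P M ×
  (∀ C D → C ⊆ E M → D ⊆ E M → Empty (C ∩ D) → Nonempty (C ∪ D) →
     P (minor M C D))

block4 : Subset 5
block4 = true ∷ true ∷ true ∷ true ∷ false ∷ []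

elem4 : Subset 5
elem4 = false ∷ false ∷ false ∷ false ∷ true ∷ []

U24⊕U11 : RawMatroid 5
U24⊕U11 = mkRaw ⊤ (λ X → (2 ⊓ ∣ X ∩ block4 ∣) + ∣ X ∩ elem4 ∣)

U24⊕U01 : RawMatroid 5
U24⊕U01 = mkRaw ⊤ (λ X → 2 ⊓ ∣ X ∩ block4 ∣)

tri₁ tri₂ : Subset 6
tri₁ = true ∷ true ∷ true ∷ false ∷ false ∷ false ∷ []
tri₂ = false ∷ false ∷ false ∷ true ∷ true ∷ true ∷ []

isTriangle : Subset 6 → Bool
isTriangle X with ∣ X ∩ tri₁ ∣ | ∣ X ∩ tri₂ ∣
... | 3 | 0 = true
... | 0 | 3 = true
... | _ | _ = false

-- R_6: rank 3 on 6 elements; its non-spanning circuits are exactly the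
-- two disjoint triangles {0,1,2} and {3,4,5} (each of rank 2).
R₆ : RawMatroid 6
R₆ = mkRaw ⊤ (λ X → if isTriangle X then 2 else 3 ⊓ ∣ X ∣)

module Submission where

-- The matroids have five or six elements, so every claim reduces to finitely
-- many facts about their rank functions.  For each claim we define a witness
-- property that implies it and can be found by exhaustive search (ZWitness
-- gives ClassZ, NotZWitness gives ¬ ClassZ, and so on), pair it with a
-- Boolean check b and a proof of 'Reflects P b', and let Agda evaluate b.
-- The mathematics lies in the implications:
--  * membership in Z and R is shown by explicit GF(2)-representations (the
--    fundamental-circuit matrix of a greedily chosen basis) and, for R, by the
--    binary matroid whose relaxation at a circuit-hyperplane H is the minor;
--  * a matroid is not binary when two circuits have a nonempty independent
--    symmetric difference, as circuits of a binary matroid have zero column sum;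
--  * M is not the relaxation at H of a binary N, because M and H already force
--    two circuits of N with such a symmetric difference.

open import Data.Nat using (ℕ; zero; suc; _+_; _∸_; _≤_; _≡ᵇ_; _≤ᵇ_; _<ᵇ_)
open import Data.Nat.Properties
  using (≡ᵇ⇒≡; ≡⇒≡ᵇ; ≤ᵇ-reflects-≤; <ᵇ-reflects-<; ≤-antisym; m≤m+n; +-comm; +-cancelˡ-≤
        ; module ≤-Reasoning)
open import Data.Bool using (Bool; true; false; T; not; _∧_; _∨_; _xor_; if_then_else_)
open import Data.Bool.Properties using (xor-assoc; xor-comm; xor-same; xor-identityˡ)
open import Data.Unit using (tt)
open import Data.Fin using (Fin; zero; suc)
open import Data.Fin.Subset
  using (Subset; _∈_; _∉_; _⊆_; _⊂_; _─_; _∪_; _∩_; _-_; ∣_∣; ⁅_⁆; ⊥; ⊤; Nonempty; Empty)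
open import Data.Fin.Subset.Properties
  using ( _∈?_; _⊂?_; drop-there; drop-∷-⊆; s⊆s; out⊆; ⊆⊤; ⊆-refl; ⊆-trans; ⊆-antisym
        ; x∈⁅x⁆; x∈⁅y⁆⇒x≡y; ∣⁅x⁆∣≡1; x∈p⇒p-x⊂p; x∈p∧x≢y⇒x∈p-y)
open import Data.List using (foldl; allFin)
open import Data.Vec using (Vec; []; _∷_; here; there; replicate; zipWith; lookup; tabulate)
open import Data.Vec.Properties using (∷-injectiveʳ; zipWith-assoc; zipWith-comm; zipWith-identityˡ)
open import Data.Product using (∃; _×_; _,_; proj₁; proj₂)
open import Data.Sum using (_⊎_; inj₁; inj₂)
open import Function using (_∘_; const)
open import Function.Bundles using (_⇔_; mk⇔; Equivalence)
open import Relation.Binary.PropositionalEquality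
  using (_≡_; _≢_; refl; sym; trans; cong; cong₂; subst; subst₂; module ≡-Reasoning)
open import Relation.Nullary using (¬_; yes; no; contradiction)
open import Relation.Nullary.Reflects
  using (Reflects; ofʸ; ofⁿ; fromEquivalence; ¬-reflects; _×-reflects_; _⊎-reflects_; _→-reflects_)

open import Defs

open Equivalence using (to; from)

-- Booleans are what
-- Agda evaluates fastest, and the proofs are only consulted symbolically.

map-reflects : ∀ {A B : Set} {b} → (A → B) → (B → A) → Reflects A b → Reflects B b
map-reflects f g (ofʸ a)  = ofʸ (f a)
map-reflects f g (ofⁿ ¬a) = ofⁿ (¬a ∘ g)

reflects-true : ∀ {A : Set} {b} → Reflects A b → T b → A
reflects-true (ofʸ a) _ = a

infix 4 _⇔ᵇ_
_⇔ᵇ_ : Bool → Bool → Bool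
true  ⇔ᵇ b = b
false ⇔ᵇ b = not b

⇔-reflects : ∀ {A B : Set} {a b} → Reflects A a → Reflects B b → Reflects (A ⇔ B) (a ⇔ᵇ b)
⇔-reflects (ofʸ a)  (ofʸ b)  = ofʸ (mk⇔ (const b) (const a))
⇔-reflects (ofʸ a)  (ofⁿ ¬b) = ofⁿ λ a⇔b → ¬b (to a⇔b a)
⇔-reflects (ofⁿ ¬a) (ofʸ b)  = ofⁿ λ a⇔b → ¬a (from a⇔b b)
⇔-reflects (ofⁿ ¬a) (ofⁿ ¬b) = ofʸ (mk⇔ (λ a → contradiction a ¬a) (λ b → contradiction b ¬b))

≡ᵇ-reflects : ∀ m n → Reflects (m ≡ n) (m ≡ᵇ n)
≡ᵇ-reflects m n = fromEquivalence (≡ᵇ⇒≡ m n) (≡⇒≡ᵇ m n)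

∈-reflects : ∀ {n} (e : Fin n) (X : Subset n) → Reflects (e ∈ X) (lookup X e)
∈-reflects zero    (true  ∷ X) = ofʸ here
∈-reflects zero    (false ∷ X) = ofⁿ λ ()
∈-reflects (suc e) (_     ∷ X) = map-reflects there drop-there (∈-reflects e X)

infix 4 _⊆ᵇ_
_⊆ᵇ_ : ∀ {n} → Subset n → Subset n → Bool
[]          ⊆ᵇ []      = true
(true  ∷ X) ⊆ᵇ (y ∷ Y) = y ∧ (X ⊆ᵇ Y)
(false ∷ X) ⊆ᵇ (_ ∷ Y) = X ⊆ᵇ Y

⊆-reflects : ∀ {n} (X Y : Subset n) → Reflects (X ⊆ Y) (X ⊆ᵇ Y)
⊆-reflects []          []           = ofʸ ⊆-refl
⊆-reflects (true  ∷ X) (true  ∷ Y) = map-reflects s⊆s drop-∷-⊆ (⊆-reflects X Y)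
⊆-reflects (true  ∷ X) (false ∷ Y) = ofⁿ λ X⊆Y → contradiction (X⊆Y here) λ ()
⊆-reflects (false ∷ X) (_     ∷ Y) = map-reflects out⊆ drop-∷-⊆ (⊆-reflects X Y)

infix 4 _==ᵇ_
_==ᵇ_ : ∀ {k} → Vec Bool k → Vec Bool k → Bool
[]      ==ᵇ []      = true
(x ∷ u) ==ᵇ (y ∷ v) = not (x xor y) ∧ (u ==ᵇ v)

==-reflects : ∀ {k} (u v : Vec Bool k) → Reflects (u ≡ v) (u ==ᵇ v)
==-reflects []          []          = ofʸ refl
==-reflects (true  ∷ u) (true  ∷ v) = map-reflects (cong (true ∷_)) ∷-injectiveʳ (==-reflects u v)
==-reflects (false ∷ u) (false ∷ v) = map-reflects (cong (false ∷_)) ∷-injectiveʳ (==-reflects u v)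
==-reflects (true  ∷ u) (false ∷ v) = ofⁿ λ ()
==-reflects (false ∷ u) (true  ∷ v) = ofⁿ λ ()

nonemptyᵇ : ∀ {n} → Subset n → Bool
nonemptyᵇ []      = false
nonemptyᵇ (x ∷ X) = x ∨ nonemptyᵇ X

nonempty-reflects : ∀ {n} (X : Subset n) → Reflects (Nonempty X) (nonemptyᵇ X)
nonempty-reflects []          = ofⁿ λ ()
nonempty-reflects (true  ∷ X) = ofʸ (zero , here)
nonempty-reflects (false ∷ X) =
  map-reflects (λ (x , x∈X) → suc x , there x∈X) (λ { (suc x , there x∈X) → x , x∈X })
               (nonempty-reflects X)

allFinᵇ : ∀ {n} → (Fin n → Bool) → Bool
allFinᵇ {zero}  f = true
allFinᵇ {suc n} f = f zero ∧ allFinᵇ (f ∘ suc)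

allFin-reflects : ∀ {n} {P : Fin n → Set} {f : Fin n → Bool} →
                  (∀ i → Reflects (P i) (f i)) → Reflects (∀ i → P i) (allFinᵇ f)
allFin-reflects {zero}          r = ofʸ λ ()
allFin-reflects {suc n} r =
  map-reflects (λ (p₀ , pₛ) → λ { zero → p₀ ; (suc i) → pₛ i }) (λ p → p zero , p ∘ suc)
               (r zero ×-reflects allFin-reflects (r ∘ suc))

anyFinᵇ : ∀ {n} → (Fin n → Bool) → Bool
anyFinᵇ {zero}  f = false
anyFinᵇ {suc n} f = f zero ∨ anyFinᵇ (f ∘ suc)

anyFin-reflects : ∀ {n} {P : Fin n → Set} {f : Fin n → Bool} →
                  (∀ i → Reflects (P i) (f i)) → Reflects (∃ P) (anyFinᵇ f)
anyFin-reflects {zero}          r = ofⁿ λ ()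
anyFin-reflects {suc n} {P = P} r = map-reflects join split (r zero ⊎-reflects anyFin-reflects (r ∘ suc))
  where
  join : P zero ⊎ ∃ (P ∘ suc) → ∃ P
  join (inj₁ p₀)      = zero , p₀
  join (inj₂ (i , p)) = suc i , p
  split : ∃ P → P zero ⊎ ∃ (P ∘ suc)
  split (zero  , p) = inj₁ p
  split (suc i , p) = inj₂ (i , p)

all⊆ᵇ : ∀ {n} → Subset n → (Subset n → Bool) → Bool
all⊆ᵇ []          f = f []
all⊆ᵇ (true  ∷ X) f = all⊆ᵇ X (f ∘ (true ∷_)) ∧ all⊆ᵇ X (f ∘ (false ∷_))
all⊆ᵇ (false ∷ X) f = all⊆ᵇ X (f ∘ (false ∷_))

any⊆ᵇ : ∀ {n} → Subset n → (Subset n → Bool) → Bool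
any⊆ᵇ []          f = f []
any⊆ᵇ (true  ∷ X) f = any⊆ᵇ X (f ∘ (true ∷_)) ∨ any⊆ᵇ X (f ∘ (false ∷_))
any⊆ᵇ (false ∷ X) f = any⊆ᵇ X (f ∘ (false ∷_))

all⊆-reflects : ∀ {n} {P : Subset n → Set} {f} (X : Subset n) → (∀ Y → Reflects (P Y) (f Y)) →
                Reflects (∀ Y → Y ⊆ X → P Y) (all⊆ᵇ X f)
all⊆-reflects [] r = map-reflects (λ p → λ { [] _ → p }) (λ h → h [] ⊆-refl) (r [])
all⊆-reflects {P = P} (true ∷ X) r =
  map-reflects merge split (all⊆-reflects X (r ∘ (true ∷_)) ×-reflects all⊆-reflects X (r ∘ (false ∷_)))
  where
  Both : Set
  Both = (∀ Y → Y ⊆ X → P (true ∷ Y)) × (∀ Y → Y ⊆ X → P (false ∷ Y))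
  merge : Both → ∀ Y → Y ⊆ true ∷ X → P Y
  merge (hᵢ , _) (true  ∷ Y) Y⊆X = hᵢ Y (drop-∷-⊆ Y⊆X)
  merge (_ , hₒ) (false ∷ Y) Y⊆X = hₒ Y (drop-∷-⊆ Y⊆X)
  split : (∀ Y → Y ⊆ true ∷ X → P Y) → Both
  split h = (λ Y Y⊆X → h (true ∷ Y) (s⊆s Y⊆X)) , (λ Y Y⊆X → h (false ∷ Y) (out⊆ Y⊆X))
all⊆-reflects {P = P} (false ∷ X) r = map-reflects extend restrict (all⊆-reflects X (r ∘ (false ∷_)))
  where
  extend : (∀ Y → Y ⊆ X → P (false ∷ Y)) → ∀ Y → Y ⊆ false ∷ X → P Y
  extend h (true  ∷ Y) Y⊆X = contradiction (Y⊆X here) λ ()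
  extend h (false ∷ Y) Y⊆X = h Y (drop-∷-⊆ Y⊆X)
  restrict : (∀ Y → Y ⊆ false ∷ X → P Y) → ∀ Y → Y ⊆ X → P (false ∷ Y)
  restrict h Y Y⊆X = h (false ∷ Y) (out⊆ Y⊆X)

any⊆-reflects : ∀ {n} {P : Subset n → Set} {f} (X : Subset n) → (∀ Y → Reflects (P Y) (f Y)) →
                Reflects (∃ λ Y → Y ⊆ X × P Y) (any⊆ᵇ X f)
any⊆-reflects [] r = map-reflects (λ p → [] , ⊆-refl , p) (λ { ([] , _ , p) → p }) (r [])
any⊆-reflects {P = P} (true ∷ X) r =
  map-reflects merge split (any⊆-reflects X (r ∘ (true ∷_)) ⊎-reflects any⊆-reflects X (r ∘ (false ∷_)))
  where
  Either : Set
  Either = (∃ λ Y → Y ⊆ X × P (true ∷ Y)) ⊎ (∃ λ Y → Y ⊆ X × P (false ∷ Y))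
  merge : Either → ∃ λ Y → Y ⊆ true ∷ X × P Y
  merge (inj₁ (Y , Y⊆X , p)) = true  ∷ Y , s⊆s Y⊆X , p
  merge (inj₂ (Y , Y⊆X , p)) = false ∷ Y , out⊆ Y⊆X , p
  split : (∃ λ Y → Y ⊆ true ∷ X × P Y) → Either
  split (true  ∷ Y , Y⊆X , p) = inj₁ (Y , drop-∷-⊆ Y⊆X , p)
  split (false ∷ Y , Y⊆X , p) = inj₂ (Y , drop-∷-⊆ Y⊆X , p)
any⊆-reflects {P = P} (false ∷ X) r = map-reflects extend restrict (any⊆-reflects X (r ∘ (false ∷_)))
  where
  extend : (∃ λ Y → Y ⊆ X × P (false ∷ Y)) → ∃ λ Y → Y ⊆ false ∷ X × P Y
  extend (Y , Y⊆X , p) = false ∷ Y , out⊆ Y⊆X , p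
  restrict : (∃ λ Y → Y ⊆ false ∷ X × P Y) → ∃ λ Y → Y ⊆ X × P (false ∷ Y)
  restrict (true  ∷ Y , Y⊆X , p) = contradiction (Y⊆X here) λ ()
  restrict (false ∷ Y , Y⊆X , p) = Y , drop-∷-⊆ Y⊆X , p

anyWithin-reflects : ∀ {n} {P : Subset n → Set} {f} (X : Subset n) →
                     (∀ Y → Reflects (P Y) (f Y)) → (∀ {Y} → P Y → Y ⊆ X) →
                     Reflects (∃ P) (any⊆ᵇ X f)
anyWithin-reflects {P = P} X r P⇒⊆X = map-reflects forget bound (any⊆-reflects X r)
  where
  forget : (∃ λ Y → Y ⊆ X × P Y) → ∃ P
  forget (Y , _ , p) = Y , p
  bound : ∃ P → ∃ λ Y → Y ⊆ X × P Y
  bound (Y , p) = Y , P⇒⊆X p , p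

allWithin-reflects : ∀ {n} {Q P : Subset n → Set} {f} (X : Subset n) →
                     (∀ Y → Reflects (Q Y → P Y) (f Y)) → (∀ {Y} → Q Y → Y ⊆ X) →
                     Reflects (∀ Y → Q Y → P Y) (all⊆ᵇ X f)
allWithin-reflects {Q = Q} {P} X r Q⇒⊆X = map-reflects (λ h Y q → h Y (Q⇒⊆X q) q) weaken (all⊆-reflects X r)
  where
  weaken : (∀ Y → Q Y → P Y) → ∀ Y → Y ⊆ X → Q Y → P Y
  weaken h Y _ = h Y

allSubsets-reflects : ∀ {n} {P : Subset n → Set} {f} → (∀ Y → Reflects (P Y) (f Y)) →
                      Reflects (∀ Y → P Y) (all⊆ᵇ ⊤ f)
allSubsets-reflects {P = P} r = map-reflects (λ h Y → h Y ⊆⊤) weaken (all⊆-reflects ⊤ r)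
  where
  weaken : (∀ Y → P Y) → ∀ Y → Y ⊆ ⊤ → P Y
  weaken h Y _ = h Y

⊆-not-⊂⇒≡ : ∀ {n} {Y X : Subset n} → Y ⊆ X → ¬ Y ⊂ X → Y ≡ X
⊆-not-⊂⇒≡ {Y = Y} {X} Y⊆X Y⊄X = ⊆-antisym Y⊆X X⊆Y
  where
  X⊆Y : X ⊆ Y
  X⊆Y {x} x∈X with x ∈? Y
  ... | yes x∈Y = x∈Y
  ... | no  x∉Y = contradiction (x , x∈X , x∉Y) (λ w → Y⊄X (Y⊆X , w))

-- The proper subsets of X are the subsets Y with X ⊈ Y.
all⊂ᵇ : ∀ {n} → Subset n → (Subset n → Bool) → Bool
all⊂ᵇ X f = all⊆ᵇ X (λ Y → (X ⊆ᵇ Y) ∨ f Y)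

all⊂-reflects : ∀ {n} {P : Subset n → Set} {f} (X : Subset n) → (∀ Y → Reflects (P Y) (f Y)) →
                Reflects (∀ Y → Y ⊂ X → P Y) (all⊂ᵇ X f)
all⊂-reflects {P = P} X r = map-reflects proper subsets (all⊆-reflects X λ Y → ⊆-reflects X Y ⊎-reflects r Y)
  where
  proper : (∀ Y → Y ⊆ X → X ⊆ Y ⊎ P Y) → ∀ Y → Y ⊂ X → P Y
  proper h Y (Y⊆X , x , x∈X , x∉Y) with h Y Y⊆X
  ... | inj₁ X⊆Y = contradiction (X⊆Y x∈X) x∉Y
  ... | inj₂ p   = p
  subsets : (∀ Y → Y ⊂ X → P Y) → ∀ Y → Y ⊆ X → X ⊆ Y ⊎ P Y
  subsets h Y Y⊆X with Y ⊂? X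
  ... | yes Y⊂X = inj₂ (h Y Y⊂X)
  ... | no  Y⊄X = inj₁ (subst (X ⊆_) (sym (⊆-not-⊂⇒≡ Y⊆X Y⊄X)) ⊆-refl)

module _ {n : ℕ} (M : RawMatroid n) where

  indepᵇ : Subset n → Bool
  indepᵇ X = (X ⊆ᵇ E M) ∧ (rk M X ≡ᵇ ∣ X ∣)

  indep-reflects : ∀ X → Reflects (Indep M X) (indepᵇ X)
  indep-reflects X = ⊆-reflects X (E M) ×-reflects ≡ᵇ-reflects (rk M X) ∣ X ∣

  basisᵇ : Subset n → Bool
  basisᵇ B = indepᵇ B ∧ (rk M B ≡ᵇ rk M (E M))

  basis-reflects : ∀ B → Reflects (IsBasis M B) (basisᵇ B)
  basis-reflects B = indep-reflects B ×-reflects ≡ᵇ-reflects (rk M B) (rk M (E M))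

  circuitᵇ : Subset n → Bool
  circuitᵇ C = (C ⊆ᵇ E M) ∧ not (indepᵇ C) ∧ all⊂ᵇ C indepᵇ

  circuit-reflects : ∀ C → Reflects (IsCircuit M C) (circuitᵇ C)
  circuit-reflects C =
    ⊆-reflects C (E M) ×-reflects ¬-reflects (indep-reflects C) ×-reflects all⊂-reflects C indep-reflects

  hyperplaneᵇ : Subset n → Bool
  hyperplaneᵇ H = (H ⊆ᵇ E M) ∧ (suc (rk M H) ≡ᵇ rk M (E M))
    ∧ allFinᵇ (λ e → not (lookup (E M) e) ∨ (not (not (lookup H e)) ∨ (rk M H <ᵇ rk M (H ∪ ⁅ e ⁆))))

  hyperplane-reflects : ∀ H → Reflects (IsHyperplane M H) (hyperplaneᵇ H)
  hyperplane-reflects H = ⊆-reflects H (E M) ×-reflects ≡ᵇ-reflects (suc (rk M H)) (rk M (E M))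
    ×-reflects allFin-reflects λ e → ∈-reflects e (E M) →-reflects
      (¬-reflects (∈-reflects e H) →-reflects <ᵇ-reflects-< (rk M H) (rk M (H ∪ ⁅ e ⁆)))

  matroidᵇ : Bool
  matroidᵇ = all⊆ᵇ (E M) (λ X → rk M X ≤ᵇ ∣ X ∣)
    ∧ all⊆ᵇ (E M) (λ Y → all⊆ᵇ Y (λ X → rk M X ≤ᵇ rk M Y))
    ∧ all⊆ᵇ (E M) (λ X → all⊆ᵇ (E M) (λ Y → rk M (X ∪ Y) + rk M (X ∩ Y) ≤ᵇ rk M X + rk M Y))

  matroid-reflects : Reflects (IsMatroid M) matroidᵇ
  matroid-reflects = map-reflects fromAxioms toAxioms
    (all⊆-reflects (E M) (λ X → ≤ᵇ-reflects-≤ (rk M X) ∣ X ∣)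
    ×-reflects all⊆-reflects (E M) (λ Y → all⊆-reflects Y (λ X → ≤ᵇ-reflects-≤ (rk M X) (rk M Y)))
    ×-reflects all⊆-reflects (E M) (λ X → all⊆-reflects (E M) (λ Y →
                 ≤ᵇ-reflects-≤ (rk M (X ∪ Y) + rk M (X ∩ Y)) (rk M X + rk M Y))))
    where
    Axioms : Set
    Axioms = (∀ X → X ⊆ E M → rk M X ≤ ∣ X ∣)
           × (∀ Y → Y ⊆ E M → ∀ X → X ⊆ Y → rk M X ≤ rk M Y)
           × (∀ X → X ⊆ E M → ∀ Y → Y ⊆ E M → rk M (X ∪ Y) + rk M (X ∩ Y) ≤ rk M X + rk M Y)
    fromAxioms : Axioms → IsMatroid M
    fromAxioms (r1 , r2 , r3) = record
      { R1 = r1 ; R2 = λ X Y sY sX → r2 Y sY X sX ; R3 = λ X Y sX sY → r3 X sX Y sY }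
    toAxioms : IsMatroid M → Axioms
    toAxioms m = R1 , (λ Y sY X sX → R2 X Y sY sX) , (λ X sX Y sY → R3 X Y sX sY)
      where open IsMatroid m

-- Vectors over GF(2).  Addition is pointwise xor; on characteristic vectors of
-- subsets it is the symmetric difference.
infixl 6 _⊕_
_⊕_ : ∀ {k} → Vec Bool k → Vec Bool k → Vec Bool k
_⊕_ = zipWith _xor_

zeros : ∀ {k} → Vec Bool k
zeros = replicate _ false

⊕-assoc : ∀ {k} (u v w : Vec Bool k) → (u ⊕ v) ⊕ w ≡ u ⊕ (v ⊕ w)
⊕-assoc = zipWith-assoc xor-assoc

⊕-comm : ∀ {k} (u v : Vec Bool k) → u ⊕ v ≡ v ⊕ u
⊕-comm = zipWith-comm xor-comm

⊕-identityˡ : ∀ {k} (u : Vec Bool k) → zeros ⊕ u ≡ u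
⊕-identityˡ = zipWith-identityˡ xor-identityˡ

⊕-self : ∀ {k} (u : Vec Bool k) → u ⊕ u ≡ zeros
⊕-self []      = refl
⊕-self (x ∷ u) = cong₂ _∷_ (xor-same x) (⊕-self u)

⊕-leftComm : ∀ {k} (a x y : Vec Bool k) → a ⊕ (x ⊕ y) ≡ x ⊕ (a ⊕ y)
⊕-leftComm a x y = begin
  a ⊕ (x ⊕ y)  ≡⟨ ⊕-assoc a x y ⟨
  a ⊕ x ⊕ y    ≡⟨ cong (_⊕ y) (⊕-comm a x) ⟩
  x ⊕ a ⊕ y    ≡⟨ ⊕-assoc x a y ⟩
  x ⊕ (a ⊕ y)  ∎
  where open ≡-Reasoning

⊕-twice : ∀ {k} (a x y : Vec Bool k) → (a ⊕ x) ⊕ (a ⊕ y) ≡ x ⊕ y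
⊕-twice a x y = begin
  a ⊕ x ⊕ (a ⊕ y)    ≡⟨ ⊕-assoc a x (a ⊕ y) ⟩
  a ⊕ (x ⊕ (a ⊕ y))  ≡⟨ cong (a ⊕_) (⊕-leftComm x a y) ⟩
  a ⊕ (a ⊕ (x ⊕ y))  ≡⟨ ⊕-assoc a a (x ⊕ y) ⟨
  a ⊕ a ⊕ (x ⊕ y)    ≡⟨ cong (_⊕ (x ⊕ y)) (⊕-self a) ⟩
  zeros ⊕ (x ⊕ y)    ≡⟨ ⊕-identityˡ (x ⊕ y) ⟩
  x ⊕ y              ∎
  where open ≡-Reasoning

colSum-⊕ : ∀ {n m} (A : Fin n → Vec Bool m) (X Y : Subset n) →
           colSum A (X ⊕ Y) ≡ colSum A X ⊕ colSum A Y
colSum-⊕ A []          []          = sym (⊕-self zeros)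
colSum-⊕ A (false ∷ X) (false ∷ Y) = colSum-⊕ (A ∘ suc) X Y
colSum-⊕ A (true  ∷ X) (false ∷ Y) =
  trans (cong (A zero ⊕_) (colSum-⊕ (A ∘ suc) X Y)) (sym (⊕-assoc _ _ _))
colSum-⊕ A (false ∷ X) (true  ∷ Y) =
  trans (cong (A zero ⊕_) (colSum-⊕ (A ∘ suc) X Y)) (⊕-leftComm _ _ _)
colSum-⊕ A (true  ∷ X) (true  ∷ Y) =
  trans (colSum-⊕ (A ∘ suc) X Y) (sym (⊕-twice (A zero) _ _))

linIndepᵇ : ∀ {n m} → (Fin n → Vec Bool m) → Subset n → Bool
linIndepᵇ A X = all⊆ᵇ X (λ Y → not (nonemptyᵇ Y) ∨ not (colSum A Y ==ᵇ zeros))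

linIndep-reflects : ∀ {n m} (A : Fin n → Vec Bool m) X → Reflects (LinIndepGF2 A X) (linIndepᵇ A X)
linIndep-reflects A X =
  all⊆-reflects X λ Y → nonempty-reflects Y →-reflects ¬-reflects (==-reflects (colSum A Y) zeros)

_Represents_ : ∀ {n m} → (Fin n → Vec Bool m) → RawMatroid n → Set
A Represents M = ∀ X → X ⊆ E M → (Indep M X ⇔ LinIndepGF2 A X)

representsᵇ : ∀ {n m} → (Fin n → Vec Bool m) → RawMatroid n → Bool
representsᵇ A M = all⊆ᵇ (E M) (λ X → indepᵇ M X ⇔ᵇ linIndepᵇ A X)

represents-reflects : ∀ {n m} (A : Fin n → Vec Bool m) M → Reflects (A Represents M) (representsᵇ A M)
represents-reflects A M = all⊆-reflects (E M) λ X → ⇔-reflects (indep-reflects M X) (linIndep-reflects A X)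

module Represented {n m} {M : RawMatroid n} {A : Fin n → Vec Bool m} (rep : A Represents M) where

  -- Subsets of independent sets are independent, as linear independence is.
  hereditary : ∀ {X Y} → Indep M X → Y ⊆ X → Indep M Y
  hereditary {X} {Y} X-indep Y⊆X = from (rep Y (⊆-trans Y⊆X (proj₁ X-indep)))
    λ Z Z⊆Y → to (rep X (proj₁ X-indep)) X-indep Z (⊆-trans Z⊆Y Y⊆X)

  -- A minimally dependent set has zero column sum: otherwise no nonempty
  -- subset would sum to zero, the proper ones being independent.
  minimalDependent-sum : ∀ {C} → C ⊆ E M → ¬ Indep M C → (∀ Y → Y ⊂ C → Indep M Y) →
                         colSum A C ≡ zeros
  minimalDependent-sum {C} C⊆E dependent minimal with colSum A C ==ᵇ zeros | ==-reflects (colSum A C) zeros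
  ... | true  | ofʸ sum≡0 = sum≡0
  ... | false | ofⁿ sum≢0 = contradiction (from (rep C C⊆E) independent) dependent
    where
    independent : LinIndepGF2 A C
    independent Y Y⊆C nonempty sum≡0 with Y ⊂? C
    ... | yes Y⊂C = to (rep Y (⊆-trans Y⊆C C⊆E)) (minimal Y Y⊂C) Y ⊆-refl nonempty sum≡0
    ... | no  Y⊄C = sum≢0 (subst (λ Z → colSum A Z ≡ zeros) (⊆-not-⊂⇒≡ Y⊆C Y⊄C) sum≡0)

  circuit-sum : ∀ {C} → IsCircuit M C → colSum A C ≡ zeros
  circuit-sum (C⊆E , dependent , minimal) = minimalDependent-sum C⊆E dependent minimal

  -- The symmetric difference of two zero-sum sets sums to zero, so it is
  -- dependent unless empty.
  zeroSums-⊕-dependent : ∀ {P Q} → colSum A P ≡ zeros → colSum A Q ≡ zeros →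
                         Nonempty (P ⊕ Q) → ¬ Indep M (P ⊕ Q)
  zeroSums-⊕-dependent {P} {Q} P-sum Q-sum nonempty indep =
    to (rep (P ⊕ Q) (proj₁ indep)) indep (P ⊕ Q) ⊆-refl nonempty (begin
      colSum A (P ⊕ Q)          ≡⟨ colSum-⊕ A P Q ⟩
      colSum A P ⊕ colSum A Q   ≡⟨ cong₂ _⊕_ P-sum Q-sum ⟩
      zeros ⊕ zeros             ≡⟨ ⊕-self zeros ⟩
      zeros                     ∎)
    where open ≡-Reasoning

NonBinaryWitness : ∀ {n} → RawMatroid n → Set
NonBinaryWitness M = ∃ λ P → IsCircuit M P × ∃ λ Q → IsCircuit M Q × Indep M (P ⊕ Q) × Nonempty (P ⊕ Q)

nonBinaryᵇ : ∀ {n} → RawMatroid n → Bool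
nonBinaryᵇ M = any⊆ᵇ (E M) λ P → circuitᵇ M P ∧
  any⊆ᵇ (E M) λ Q → circuitᵇ M Q ∧ indepᵇ M (P ⊕ Q) ∧ nonemptyᵇ (P ⊕ Q)

nonBinary-reflects : ∀ {n} (M : RawMatroid n) → Reflects (NonBinaryWitness M) (nonBinaryᵇ M)
nonBinary-reflects M =
  anyWithin-reflects (E M) (λ P → circuit-reflects M P ×-reflects
    anyWithin-reflects (E M) (λ Q → circuit-reflects M Q ×-reflects indep-reflects M (P ⊕ Q)
      ×-reflects nonempty-reflects (P ⊕ Q)) circuit⊆E) circuit⊆E
  where
  circuit⊆E : ∀ {C} {R : Set} → IsCircuit M C × R → C ⊆ E M
  circuit⊆E ((C⊆E , _) , _) = C⊆E

nonBinary : ∀ {n} (M : RawMatroid n) → NonBinaryWitness M → ¬ Binary M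
nonBinary _ (P , P-circuit , Q , Q-circuit , indep , nonempty) (_ , A , rep) =
  zeroSums-⊕-dependent (circuit-sum P-circuit) (circuit-sum Q-circuit) nonempty indep
  where open Represented rep

-- Choose a basis B greedily; column e is the
-- unit vector of e for e ∈ B, and otherwise the incidence vector of the
-- fundamental circuit of e, i.e. of those b ∈ B with (B - b) ∪ {e} independent.
-- If M is binary this matrix represents it; here that is simply checked.
greedyBasis : ∀ {n} → RawMatroid n → Subset n
greedyBasis {n} M = foldl extend ⊥ (allFin n)
  where
  extend : Subset n → Fin n → Subset n
  extend B e = if indepᵇ M (B ∪ ⁅ e ⁆) then B ∪ ⁅ e ⁆ else B

fundamentalMatrix : ∀ {n} → RawMatroid n → Subset n → Fin n → Vec Bool n
fundamentalMatrix M B e =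
  if lookup B e then ⁅ e ⁆ else tabulate (λ b → lookup B b ∧ indepᵇ M ((B - b) ∪ ⁅ e ⁆))

-- The columns are tabulated once, so that all column sums share them.
standardMatrix : ∀ {n} → RawMatroid n → Fin n → Vec Bool n
standardMatrix M = lookup (tabulate (fundamentalMatrix M (greedyBasis M)))

StdBinary : ∀ {n} → RawMatroid n → Set
StdBinary M = standardMatrix M Represents M

stdBinaryᵇ : ∀ {n} → RawMatroid n → Bool
stdBinaryᵇ M = representsᵇ (standardMatrix M) M

stdBinary-reflects : ∀ {n} (M : RawMatroid n) → Reflects (StdBinary M) (stdBinaryᵇ M)
stdBinary-reflects M = represents-reflects (standardMatrix M) M

stdBinary⇒binary : ∀ {n} {M : RawMatroid n} → StdBinary M → Binary M
stdBinary⇒binary rep = _ , _ , rep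

ZWitness : ∀ {n} → RawMatroid n → Set
ZWitness M = ∀ e → e ∈ E M → StdBinary (M ＼ e) ⊎ StdBinary (M ／ e)

zWitnessᵇ : ∀ {n} → RawMatroid n → Bool
zWitnessᵇ M = allFinᵇ λ e → not (lookup (E M) e) ∨ (stdBinaryᵇ (M ＼ e) ∨ stdBinaryᵇ (M ／ e))

zWitness-reflects : ∀ {n} (M : RawMatroid n) → Reflects (ZWitness M) (zWitnessᵇ M)
zWitness-reflects M = allFin-reflects λ e →
  ∈-reflects e (E M) →-reflects (stdBinary-reflects (M ＼ e) ⊎-reflects stdBinary-reflects (M ／ e))

inZ : ∀ {n} (M : RawMatroid n) → ZWitness M → ClassZ M
inZ _ z e e∈E with z e e∈E
... | inj₁ del = inj₁ (stdBinary⇒binary del)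
... | inj₂ con = inj₂ (stdBinary⇒binary con)

NotZWitness : ∀ {n} → RawMatroid n → Set
NotZWitness M = ∃ λ e → e ∈ E M × NonBinaryWitness (M ＼ e) × NonBinaryWitness (M ／ e)

notZWitnessᵇ : ∀ {n} → RawMatroid n → Bool
notZWitnessᵇ M = anyFinᵇ λ e → lookup (E M) e ∧ nonBinaryᵇ (M ＼ e) ∧ nonBinaryᵇ (M ／ e)

notZWitness-reflects : ∀ {n} (M : RawMatroid n) → Reflects (NotZWitness M) (notZWitnessᵇ M)
notZWitness-reflects M = anyFin-reflects λ e →
  ∈-reflects e (E M) ×-reflects nonBinary-reflects (M ＼ e) ×-reflects nonBinary-reflects (M ／ e)

notInZ : ∀ {n} (M : RawMatroid n) → NotZWitness M → ¬ ClassZ M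
notInZ M (e , e∈E , del , con) z with z e e∈E
... | inj₁ del-binary = nonBinary (M ＼ e) del del-binary
... | inj₂ con-binary = nonBinary (M ／ e) con con-binary

-- The only candidate for a matroid whose relaxation at H is M: it agrees with
-- M except that H loses one unit of rank.
unrelax : ∀ {n} → RawMatroid n → Subset n → RawMatroid n
unrelax M H = mkRaw (E M) (λ X → if X ==ᵇ H then rk M X ∸ 1 else rk M X)

-- M is the relaxation of the binary matroid 'unrelax M H' at its
-- circuit-hyperplane H.  The cheap conditions come first.
RelaxationWitness : ∀ {n} → RawMatroid n → Subset n → Set
RelaxationWitness M H = IsCircuitHyperplane (unrelax M H) H
                      × (∀ B → IsBasis M B ⇔ (IsBasis (unrelax M H) B ⊎ B ≡ H))
                      × StdBinary (unrelax M H) × IsMatroid (unrelax M H)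

relaxationᵇ : ∀ {n} → RawMatroid n → Subset n → Bool
relaxationᵇ {n} M H = (circuitᵇ N H ∧ hyperplaneᵇ N H)
  ∧ all⊆ᵇ ⊤ (λ B → basisᵇ M B ⇔ᵇ (basisᵇ N B ∨ (B ==ᵇ H))) ∧ stdBinaryᵇ N ∧ matroidᵇ N
  where
  N : RawMatroid n
  N = unrelax M H

relaxation-reflects : ∀ {n} (M : RawMatroid n) H → Reflects (RelaxationWitness M H) (relaxationᵇ M H)
relaxation-reflects {n} M H =
  (circuit-reflects N H ×-reflects hyperplane-reflects N H)
  ×-reflects allSubsets-reflects (λ B → ⇔-reflects (basis-reflects M B) (basis-reflects N B ⊎-reflects ==-reflects B H))
  ×-reflects stdBinary-reflects N ×-reflects matroid-reflects N
  where
  N : RawMatroid n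
  N = unrelax M H

RWitness : ∀ {n} → RawMatroid n → Set
RWitness M = StdBinary M ⊎ ∃ (RelaxationWitness M)

rWitnessᵇ : ∀ {n} → RawMatroid n → Bool
rWitnessᵇ M = stdBinaryᵇ M ∨ any⊆ᵇ (E M) (relaxationᵇ M)

rWitness-reflects : ∀ {n} (M : RawMatroid n) → Reflects (RWitness M) (rWitnessᵇ M)
rWitness-reflects M =
  stdBinary-reflects M ⊎-reflects anyWithin-reflects (E M) (relaxation-reflects M) H⊆E
  where
  H⊆E : ∀ {H} → RelaxationWitness M H → H ⊆ E M
  H⊆E (((H⊆E , _) , _) , _) = H⊆E

inR : ∀ {n} (M : RawMatroid n) → RWitness M → ClassR M
inR _ (inj₁ rep) = inj₁ (stdBinary⇒binary rep)
inR M (inj₂ (H , circuitHyperplane , bases , rep , matroid)) =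
  inj₂ (unrelax M H , matroid , stdBinary⇒binary rep , refl , H , circuitHyperplane , bases)

-- Suppose M is the relaxation at H of a matroid N.  Then the following sets are
-- independent in N: subsets of bases of M other than H (these are bases of N),
-- subsets of H - x (H is a circuit of N), and singletons outside H (H is a
-- hyperplane of N, so no element outside it is a loop).
ForcedIndep : ∀ {n} → RawMatroid n → Subset n → Subset n → Set
ForcedIndep M H X = (∃ λ B → (IsBasis M B × B ≢ H) × X ⊆ B)
                  ⊎ (∃ λ x → x ∈ H × X ⊆ H - x)
                  ⊎ (∃ λ e → e ∈ E M × e ∉ H × X ≡ ⁅ e ⁆)

-- ... and these are dependent in N: H itself, and sets of size r(M) which are
-- not bases of M (the bases of N are bases of M, of the same rank).
ForcedDep : ∀ {n} → RawMatroid n → Subset n → Subset n → Set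
ForcedDep M H X = X ≡ H ⊎ (∣ X ∣ ≡ rk M (E M) × ¬ IsBasis M X)

ForcedCircuit : ∀ {n} → RawMatroid n → Subset n → Subset n → Set
ForcedCircuit M H C = C ⊆ E M × ForcedDep M H C × (∀ c → c ∈ C → ForcedIndep M H (C - c))

module _ {n : ℕ} (M : RawMatroid n) (H : Subset n) where

  otherBasisᵇ : Subset n → Bool
  otherBasisᵇ B = basisᵇ M B ∧ not (B ==ᵇ H)

  otherBasis-reflects : ∀ B → Reflects (IsBasis M B × B ≢ H) (otherBasisᵇ B)
  otherBasis-reflects B = basis-reflects M B ×-reflects ¬-reflects (==-reflects B H)

  otherBasis⊆E : ∀ {B} → IsBasis M B × B ≢ H → B ⊆ E M
  otherBasis⊆E ((B-indep , _) , _) = proj₁ B-indep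

  forcedIndepᵇ : Subset n → Bool
  forcedIndepᵇ X = any⊆ᵇ (E M) (λ B → otherBasisᵇ B ∧ (X ⊆ᵇ B))
    ∨ anyFinᵇ (λ x → lookup H x ∧ (X ⊆ᵇ H - x))
    ∨ anyFinᵇ (λ e → lookup (E M) e ∧ not (lookup H e) ∧ (X ==ᵇ ⁅ e ⁆))

  forcedIndep-reflects : ∀ X → Reflects (ForcedIndep M H X) (forcedIndepᵇ X)
  forcedIndep-reflects X =
    anyWithin-reflects (E M) (λ B → otherBasis-reflects B ×-reflects ⊆-reflects X B) (otherBasis⊆E ∘ proj₁)
    ⊎-reflects anyFin-reflects (λ x → ∈-reflects x H ×-reflects ⊆-reflects X (H - x))
    ⊎-reflects anyFin-reflects (λ e → ∈-reflects e (E M) ×-reflects ¬-reflects (∈-reflects e H)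
                                        ×-reflects ==-reflects X ⁅ e ⁆)

  forcedDepᵇ : Subset n → Bool
  forcedDepᵇ X = (X ==ᵇ H) ∨ ((∣ X ∣ ≡ᵇ rk M (E M)) ∧ not (basisᵇ M X))

  forcedDep-reflects : ∀ X → Reflects (ForcedDep M H X) (forcedDepᵇ X)
  forcedDep-reflects X =
    ==-reflects X H ⊎-reflects (≡ᵇ-reflects ∣ X ∣ (rk M (E M)) ×-reflects ¬-reflects (basis-reflects M X))

  forcedCircuitᵇ : Subset n → Bool
  forcedCircuitᵇ C = (C ⊆ᵇ E M) ∧ forcedDepᵇ C ∧ allFinᵇ (λ c → not (lookup C c) ∨ forcedIndepᵇ (C - c))

  forcedCircuit-reflects : ∀ C → Reflects (ForcedCircuit M H C) (forcedCircuitᵇ C)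
  forcedCircuit-reflects C = ⊆-reflects C (E M) ×-reflects forcedDep-reflects C
    ×-reflects allFin-reflects (λ c → ∈-reflects c C →-reflects forcedIndep-reflects (C - c))

-- Non-membership in R: M is not binary, and for every basis H of M (the only
-- candidates for a relaxed circuit-hyperplane) there is a second basis and two
-- forced circuits of N whose symmetric difference is nonempty and forced
-- independent.
NotRelaxationWitness : ∀ {n} → RawMatroid n → Set
NotRelaxationWitness M = ∀ H → IsBasis M H →
  (∃ λ B → IsBasis M B × B ≢ H) ×
  (∃ λ P → ForcedCircuit M H P × ∃ λ Q → ForcedCircuit M H Q × ForcedIndep M H (P ⊕ Q) × Nonempty (P ⊕ Q))

notRelaxationᵇ : ∀ {n} → RawMatroid n → Bool
notRelaxationᵇ M = all⊆ᵇ (E M) λ H → not (basisᵇ M H) ∨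
  (any⊆ᵇ (E M) (otherBasisᵇ M H) ∧
   any⊆ᵇ (E M) λ P → forcedCircuitᵇ M H P ∧
     any⊆ᵇ (E M) λ Q → forcedCircuitᵇ M H Q ∧ forcedIndepᵇ M H (P ⊕ Q) ∧ nonemptyᵇ (P ⊕ Q))

notRelaxation-reflects : ∀ {n} (M : RawMatroid n) → Reflects (NotRelaxationWitness M) (notRelaxationᵇ M)
notRelaxation-reflects M =
  allWithin-reflects (E M) (λ H → basis-reflects M H →-reflects
    (anyWithin-reflects (E M) (otherBasis-reflects M H) (otherBasis⊆E M H) ×-reflects
     anyWithin-reflects (E M) (λ P → forcedCircuit-reflects M H P ×-reflects
       anyWithin-reflects (E M) (λ Q → forcedCircuit-reflects M H Q ×-reflects
         forcedIndep-reflects M H (P ⊕ Q) ×-reflects nonempty-reflects (P ⊕ Q)) circuit⊆E) circuit⊆E))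
    basis⊆E
  where
  basis⊆E : ∀ {B} → IsBasis M B → B ⊆ E M
  basis⊆E (B-indep , _) = proj₁ B-indep
  circuit⊆E : ∀ {H C} {R : Set} → ForcedCircuit M H C × R → C ⊆ E M
  circuit⊆E ((C⊆E , _) , _) = C⊆E

module Forced {n m} {M N : RawMatroid n} {H : Subset n} {A : Fin n → Vec Bool m}
  (N-matroid : IsMatroid N) (rep : A Represents N) (sameE : E N ≡ E M)
  (H-circuit : IsCircuit N H) (H-hyperplane : IsHyperplane N H)
  (bases : ∀ B → IsBasis M B ⇔ (IsBasis N B ⊎ B ≡ H))
  {B₀ : Subset n} (B₀-basis : IsBasis M B₀) (B₀≢H : B₀ ≢ H) where

  open IsMatroid N-matroid
  open Represented rep

  inE : ∀ {X} → X ⊆ E M → X ⊆ E N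
  inE {X} = subst (X ⊆_) (sym sameE)

  basisOfN : ∀ {B} → IsBasis M B → B ≢ H → IsBasis N B
  basisOfN {B} B-basis B≢H with to (bases B) B-basis
  ... | inj₁ N-basis = N-basis
  ... | inj₂ B≡H     = contradiction B≡H B≢H

  -- An element outside the hyperplane H raises its rank, so by submodularity
  -- it has rank one by itself.
  nonLoop : ∀ {e} → e ∈ E M → e ∉ H → Indep N ⁅ e ⁆
  nonLoop {e} e∈E e∉H =
    e-inE , ≤-antisym (R1 ⁅ e ⁆ e-inE) (subst (_≤ rk N ⁅ e ⁆) (sym (∣⁅x⁆∣≡1 e)) one≤rank)
    where
    open ≤-Reasoning
    e-inE : ⁅ e ⁆ ⊆ E N
    e-inE = inE λ x∈⁅e⁆ → subst (_∈ E M) (sym (x∈⁅y⁆⇒x≡y e x∈⁅e⁆)) e∈E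
    one≤rank : 1 ≤ rk N ⁅ e ⁆
    one≤rank = +-cancelˡ-≤ (rk N H) 1 (rk N ⁅ e ⁆) (begin
      rk N H + 1                              ≡⟨ +-comm (rk N H) 1 ⟩
      suc (rk N H)                            ≤⟨ proj₂ (proj₂ H-hyperplane) e (e-inE (x∈⁅x⁆ e)) e∉H ⟩
      rk N (H ∪ ⁅ e ⁆)                        ≤⟨ m≤m+n _ _ ⟩
      rk N (H ∪ ⁅ e ⁆) + rk N (H ∩ ⁅ e ⁆)     ≤⟨ R3 H ⁅ e ⁆ (proj₁ H-hyperplane) e-inE ⟩
      rk N H + rk N ⁅ e ⁆                     ∎)

  forcedIndep-sound : ∀ {X} → ForcedIndep M H X → Indep N X
  forcedIndep-sound (inj₁ (B , (B-basis , B≢H) , X⊆B)) = hereditary (proj₁ (basisOfN B-basis B≢H)) X⊆B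
  forcedIndep-sound (inj₂ (inj₁ (x , x∈H , X⊆H-x))) =
    hereditary (proj₂ (proj₂ H-circuit) (H - x) (x∈p⇒p-x⊂p x∈H)) X⊆H-x
  forcedIndep-sound (inj₂ (inj₂ (e , e∈E , e∉H , refl))) = nonLoop e∈E e∉H

  -- M and N have the same rank, computed on their common basis B₀.
  sameRank : rk N (E N) ≡ rk M (E M)
  sameRank = begin
    rk N (E N)  ≡⟨ proj₂ B₀-basisOfN ⟨
    rk N B₀     ≡⟨ proj₂ (proj₁ B₀-basisOfN) ⟩
    ∣ B₀ ∣      ≡⟨ proj₂ (proj₁ B₀-basis) ⟨
    rk M B₀     ≡⟨ proj₂ B₀-basis ⟩
    rk M (E M)  ∎
    where
    open ≡-Reasoning
    B₀-basisOfN : IsBasis N B₀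
    B₀-basisOfN = basisOfN B₀-basis B₀≢H

  forcedDep-sound : ∀ {X} → ForcedDep M H X → ¬ Indep N X
  forcedDep-sound (inj₁ refl) = proj₁ (proj₂ H-circuit)
  forcedDep-sound {X} (inj₂ (size , notBasis)) X-indep =
    notBasis (from (bases X) (inj₁ (X-indep , trans (proj₂ X-indep) (trans size (sym sameRank)))))

  forcedCircuit-sum : ∀ {C} → ForcedCircuit M H C → colSum A C ≡ zeros
  forcedCircuit-sum {C} (C⊆E , dependent , deletions) =
    minimalDependent-sum (inE C⊆E) (forcedDep-sound dependent) minimal
    where
    minimal : ∀ Y → Y ⊂ C → Indep N Y
    minimal Y (Y⊆C , c , c∈C , c∉Y) = hereditary (forcedIndep-sound (deletions c c∈C))
      λ y∈Y → x∈p∧x≢y⇒x∈p-y (Y⊆C y∈Y) λ { refl → c∉Y y∈Y }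

notInR : ∀ {n} (M : RawMatroid n) → NonBinaryWitness M → NotRelaxationWitness M → ¬ ClassR M
notInR M nonBinaryM _ (inj₁ binary) = nonBinary M nonBinaryM binary
notInR _ _ noRelaxation (inj₂ (N , N-matroid , (_ , A , rep) , sameE , H , (H-circuit , H-hyperplane) , bases))
  with noRelaxation H (from (bases H) (inj₂ refl))
... | (B₀ , B₀-basis , B₀≢H) , (P , P-circuit , Q , Q-circuit , indep , nonempty) =
  zeroSums-⊕-dependent (forcedCircuit-sum P-circuit) (forcedCircuit-sum Q-circuit) nonempty
    (forcedIndep-sound indep)
  where
  open Represented rep
  open Forced N-matroid rep sameE H-circuit H-hyperplane bases B₀-basis B₀≢H

ProperMinorsIn : ∀ {n} → (RawMatroid n → Set) → RawMatroid n → Set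
ProperMinorsIn P M = ∀ C D → C ⊆ E M → D ⊆ E M → Empty (C ∩ D) → Nonempty (C ∪ D) → P (minor M C D)

properMinorsᵇ : ∀ {n} → (RawMatroid n → Bool) → RawMatroid n → Bool
properMinorsᵇ p M = all⊆ᵇ (E M) λ C → all⊆ᵇ (E M) λ D →
  not (not (nonemptyᵇ (C ∩ D))) ∨ (not (nonemptyᵇ (C ∪ D)) ∨ p (minor M C D))

properMinors-reflects : ∀ {n} {P : RawMatroid n → Set} {p} → (∀ N → Reflects (P N) (p N)) →
                        ∀ M → Reflects (ProperMinorsIn P M) (properMinorsᵇ p M)
properMinors-reflects {P = P} r M = map-reflects reorder (λ h C sC D sD → h C D sC sD)
  (all⊆-reflects (E M) λ C → all⊆-reflects (E M) λ D →
     ¬-reflects (nonempty-reflects (C ∩ D)) →-reflects nonempty-reflects (C ∪ D) →-reflects r (minor M C D))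
  where
  reorder : (∀ C → C ⊆ E M → ∀ D → D ⊆ E M → Empty (C ∩ D) → Nonempty (C ∪ D) → P (minor M C D)) →
            ProperMinorsIn P M
  reorder h C D sC sD = h C sC D sD

properMinorsIn-map : ∀ {n} {P Q : RawMatroid n → Set} → (∀ N → P N → Q N) →
                     ∀ M → ProperMinorsIn P M → ProperMinorsIn Q M
properMinorsIn-map P⇒Q M minors C D sC sD disjoint nonempty = P⇒Q (minor M C D) (minors C D sC sD disjoint nonempty)

Certified : ∀ {n} → RawMatroid n → Set
Certified M = IsMatroid M
            × (NotZWitness M × ProperMinorsIn ZWitness M)
            × (NonBinaryWitness M × NotRelaxationWitness M × ProperMinorsIn RWitness M)

certifiedᵇ : ∀ {n} → RawMatroid n → Bool
certifiedᵇ M = matroidᵇ M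
  ∧ (notZWitnessᵇ M ∧ properMinorsᵇ zWitnessᵇ M)
  ∧ (nonBinaryᵇ M ∧ notRelaxationᵇ M ∧ properMinorsᵇ rWitnessᵇ M)

certified-reflects : ∀ {n} (M : RawMatroid n) → Reflects (Certified M) (certifiedᵇ M)
certified-reflects M = matroid-reflects M
  ×-reflects (notZWitness-reflects M ×-reflects properMinors-reflects zWitness-reflects M)
  ×-reflects (nonBinary-reflects M ×-reflects notRelaxation-reflects M ×-reflects properMinors-reflects rWitness-reflects M)

ExcludedMinorForZandR : ∀ {n} → RawMatroid n → Set
ExcludedMinorForZandR M = IsMatroid M × ExcludedMinor ClassZ M × ExcludedMinor ClassR M

certified⇒excluded : ∀ {n} (M : RawMatroid n) → Certified M → ExcludedMinorForZandR M
certified⇒excluded M (matroid , (notZ , minorsZ) , (nonBinaryM , noRelaxation , minorsR)) =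
  matroid , (notInZ M notZ , properMinorsIn-map inZ M minorsZ)
          , (notInR M nonBinaryM noRelaxation , properMinorsIn-map inR M minorsR)

record _≈_ {n : ℕ} (M₁ M₂ : RawMatroid n) : Set where
  field
    sameE  : E M₁ ≡ E M₂
    sameRk : ∀ X → rk M₁ X ≡ rk M₂ X
open _≈_

≈-sym : ∀ {n} {M₁ M₂ : RawMatroid n} → M₁ ≈ M₂ → M₂ ≈ M₁
≈-sym M₁≈M₂ = record { sameE = sym (sameE M₁≈M₂) ; sameRk = λ X → sym (sameRk M₁≈M₂ X) }

≈-⊆E : ∀ {n} {M₁ M₂ : RawMatroid n} → M₁ ≈ M₂ → ∀ {X} → X ⊆ E M₁ → X ⊆ E M₂
≈-⊆E M₁≈M₂ {X} = subst (X ⊆_) (sameE M₁≈M₂)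

module _ {n : ℕ} {M₁ M₂ : RawMatroid n} (M₁≈M₂ : M₁ ≈ M₂) where

  ≈-minor : ∀ C D → minor M₁ C D ≈ minor M₂ C D
  ≈-minor C D = record
    { sameE = cong (_─ (C ∪ D)) (sameE M₁≈M₂)
    ; sameRk = λ X → cong₂ _∸_ (sameRk M₁≈M₂ (X ∪ C)) (sameRk M₁≈M₂ C) }

  ≈-indep : ∀ {X} → Indep M₁ X → Indep M₂ X
  ≈-indep {X} (X⊆E , rank) = ≈-⊆E M₁≈M₂ X⊆E , trans (sym (sameRk M₁≈M₂ X)) rank

  ≈-basis : ∀ {B} → IsBasis M₁ B → IsBasis M₂ B
  ≈-basis {B} (B-indep , rank) = ≈-indep B-indep , (begin
    rk M₂ B         ≡⟨ sameRk M₁≈M₂ B ⟨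
    rk M₁ B         ≡⟨ rank ⟩
    rk M₁ (E M₁)    ≡⟨ sameRk M₁≈M₂ (E M₁) ⟩
    rk M₂ (E M₁)    ≡⟨ cong (rk M₂) (sameE M₁≈M₂) ⟩
    rk M₂ (E M₂)    ∎)
    where open ≡-Reasoning

  ≈-matroid : IsMatroid M₁ → IsMatroid M₂
  ≈-matroid m = record
    { R1 = λ X sX → subst (_≤ ∣ X ∣) (sameRk M₁≈M₂ X) (R1 X (⊆E⁻ sX))
    ; R2 = λ X Y sY X⊆Y → subst₂ _≤_ (sameRk M₁≈M₂ X) (sameRk M₁≈M₂ Y) (R2 X Y (⊆E⁻ sY) X⊆Y)
    ; R3 = λ X Y sX sY → subst₂ _≤_ (cong₂ _+_ (sameRk M₁≈M₂ (X ∪ Y)) (sameRk M₁≈M₂ (X ∩ Y)))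
                                    (cong₂ _+_ (sameRk M₁≈M₂ X) (sameRk M₁≈M₂ Y))
                                    (R3 X Y (⊆E⁻ sX) (⊆E⁻ sY)) }
    where
    open IsMatroid m
    ⊆E⁻ : ∀ {X} → X ⊆ E M₂ → X ⊆ E M₁
    ⊆E⁻ = ≈-⊆E (≈-sym M₁≈M₂)

≈-binary : ∀ {n} {M₁ M₂ : RawMatroid n} → M₁ ≈ M₂ → Binary M₁ → Binary M₂
≈-binary M₁≈M₂ (m , A , rep) = m , A , λ X X⊆E →
  let equiv = rep X (≈-⊆E (≈-sym M₁≈M₂) X⊆E)
  in mk⇔ (to equiv ∘ ≈-indep (≈-sym M₁≈M₂)) (≈-indep M₁≈M₂ ∘ from equiv)

≈-classZ : ∀ {n} {M₁ M₂ : RawMatroid n} → M₁ ≈ M₂ → ClassZ M₁ → ClassZ M₂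
≈-classZ M₁≈M₂ z e e∈E with z e (subst (e ∈_) (sym (sameE M₁≈M₂)) e∈E)
... | inj₁ del = inj₁ (≈-binary (≈-minor M₁≈M₂ ⊥ ⁅ e ⁆) del)
... | inj₂ con = inj₂ (≈-binary (≈-minor M₁≈M₂ ⁅ e ⁆ ⊥) con)

≈-classR : ∀ {n} {M₁ M₂ : RawMatroid n} → M₁ ≈ M₂ → ClassR M₁ → ClassR M₂
≈-classR M₁≈M₂ (inj₁ binary) = inj₁ (≈-binary M₁≈M₂ binary)
≈-classR M₁≈M₂ (inj₂ (N , N-matroid , N-binary , E≡E , H , circuitHyperplane , bases)) =
  inj₂ (N , N-matroid , N-binary , trans E≡E (sameE M₁≈M₂) , H , circuitHyperplane , λ B →
    mk⇔ (to (bases B) ∘ ≈-basis (≈-sym M₁≈M₂)) (≈-basis M₁≈M₂ ∘ from (bases B)))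

≈-excludedMinor : ∀ {n} {P : RawMatroid n → Set} → (∀ {M₁ M₂} → M₁ ≈ M₂ → P M₁ → P M₂) →
                  ∀ {M₁ M₂} → M₁ ≈ M₂ → ExcludedMinor P M₁ → ExcludedMinor P M₂
≈-excludedMinor respects M₁≈M₂ (notP , minors) =
  (notP ∘ respects (≈-sym M₁≈M₂)) ,
  λ C D sC sD disjoint nonempty →
    respects (≈-minor M₁≈M₂ C D)
             (minors C D (≈-⊆E (≈-sym M₁≈M₂) sC) (≈-⊆E (≈-sym M₁≈M₂) sD) disjoint nonempty)

≈-excludedMinorForZandR : ∀ {n} {M₁ M₂ : RawMatroid n} → M₁ ≈ M₂ →
                          ExcludedMinorForZandR M₁ → ExcludedMinorForZandR M₂
≈-excludedMinorForZandR M₁≈M₂ (matroid , forZ , forR) =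
  ≈-matroid M₁≈M₂ matroid , ≈-excludedMinor ≈-classZ M₁≈M₂ forZ , ≈-excludedMinor ≈-classR M₁≈M₂ forR

-- Memoisation.  A binary tree with one leaf per subset of Fin n stores the
-- rank function, so that during a check every rank is computed only once.
data RankTable : ℕ → Set where
  leaf : ℕ → RankTable zero
  node : ∀ {n} → (inside outside : RankTable n) → RankTable (suc n)

tabulateRanks : ∀ {n} → (Subset n → ℕ) → RankTable n
tabulateRanks {zero}  r = leaf (r [])
tabulateRanks {suc n} r = node (tabulateRanks (r ∘ (true ∷_))) (tabulateRanks (r ∘ (false ∷_)))

lookupRank : ∀ {n} → RankTable n → Subset n → ℕ
lookupRank (leaf k)   []          = k
lookupRank (node t _) (true  ∷ X) = lookupRank t X
lookupRank (node _ f) (false ∷ X) = lookupRank f X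

lookup-tabulateRanks : ∀ {n} (r : Subset n → ℕ) X → lookupRank (tabulateRanks r) X ≡ r X
lookup-tabulateRanks r []          = refl
lookup-tabulateRanks r (true  ∷ X) = lookup-tabulateRanks (r ∘ (true ∷_)) X
lookup-tabulateRanks r (false ∷ X) = lookup-tabulateRanks (r ∘ (false ∷_)) X

memo : ∀ {n} → RawMatroid n → RawMatroid n
memo M = mkRaw (E M) (lookupRank (tabulateRanks (rk M)))

memo≈ : ∀ {n} (M : RawMatroid n) → memo M ≈ M
memo≈ M = record { sameE = refl ; sameRk = lookup-tabulateRanks (rk M) }

excludedMinorForZandR : ∀ {n} (M : RawMatroid n) → T (certifiedᵇ (memo M)) → ExcludedMinorForZandR M
excludedMinorForZandR M ok = ≈-excludedMinorForZandR (memo≈ M)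
  (certified⇒excluded (memo M) (reflects-true (certified-reflects (memo M)) ok))

lemma2p4 : (IsMatroid U24⊕U11 × ExcludedMinor ClassZ U24⊕U11 × ExcludedMinor ClassR U24⊕U11)
         × (IsMatroid U24⊕U01 × ExcludedMinor ClassZ U24⊕U01 × ExcludedMinor ClassR U24⊕U01)
         × (IsMatroid R₆ × ExcludedMinor ClassZ R₆ × ExcludedMinor ClassR R₆)
lemma2p4 = excludedMinorForZandR U24⊕U11 tt
         , excludedMinorForZandR U24⊕U01 tt
         , excludedMinorForZandR R₆ tt
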